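{- Let $p$ be a prime. The independence number of the intersection graph $\Gamma(D_{2p^2})$ is $p^2+1$.
   Context: $D_{2n}=\langle r,s : r^n=s^2=1,\ srs=r^{ -1}\rangle$ is the dihedral group of order $2n$. The intersection graph $\Gamma(G)$ of a finite group $G$ has as vertices the proper non-trivial subgroups of $G$, two distinct vertices being adjacent iff their intersection is non-trivial. The independence number is the maximum cardinality of a set of pairwise non-adjacent vertices. -}

module Defs where

open import Data.Nat using (ℕ; zero; suc; _+_; _∸_; _≤_)
open import Data.Nat.DivMod using (_mod_)
open import Data.Fin using (Fin; toℕ)
open import Data.Fin.Subset using (Subset; _∈_; _∉_)
open import Data.Bool using (Bool; true; false; _xor_; if_then_else_)
open import Data.Product using (_×_; _,_; ∃)
open import Data.List using (List; length)
open import Data.List.Relation.Unary.All using (All)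
open import Data.List.Relation.Unary.AllPairs using (AllPairs)
open import Relation.Binary.PropositionalEquality using (_≡_; _≢_)
open import Relation.Nullary using (¬_)

addF : ∀ {n} → Fin n → Fin n → Fin n
addF {suc m} i j = (toℕ i + toℕ j) mod suc m

negF : ∀ {n} → Fin n → Fin n
negF {suc m} j = (suc m ∸ toℕ j) mod suc m

-- Dihedral group D_{2n}: the element (i , b) stands for r^i s^b
-- (b = false: rotation r^i; b = true: reflection r^i s).
D : ℕ → Set
D n = Fin n × Bool

-- (r^i s^a)(r^j s^b) = r^(i + (-1)^a j) s^(a+b), using s r^j = r^(-j) s.
_·_ : ∀ {n} → D n → D n → D n
(i , a) · (j , b) = addF i (if a then negF j else j) , (a xor b)

inv : ∀ {n} → D n → D n
inv (i , false) = negF i , false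
inv (i , true)  = i , true

IsId : ∀ {n} → D n → Set
IsId (i , b) = (toℕ i ≡ 0) × (b ≡ false)

-- A subset of D_{2n}: (set of rotation exponents , set of reflection exponents)
Sub : ℕ → Set
Sub n = Subset n × Subset n

_∈D_ : ∀ {n} → D n → Sub n → Set
(i , false) ∈D (R , S) = i ∈ R
(i , true)  ∈D (R , S) = i ∈ S

IsSubgroup : ∀ {n} → Sub n → Set
IsSubgroup {n} H =
  (∀ (x : D n) → IsId x → x ∈D H) ×
  (∀ (x y : D n) → x ∈D H → y ∈D H → (x · y) ∈D H) ×
  (∀ (x : D n) → x ∈D H → inv x ∈D H)

-- vertices of the intersection graph: proper non-trivial subgroups
IsVertex : ∀ {n} → Sub n → Set
IsVertex {n} H =
  IsSubgroup H ×
  (∃ λ (x : D n) → x ∈D H × ¬ IsId x) ×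
  (∃ λ (x : D n) → ¬ (x ∈D H))

-- non-adjacent: intersection is trivial
TrivialMeet : ∀ {n} → Sub n → Sub n → Set
TrivialMeet {n} H K = ∀ (x : D n) → x ∈D H → x ∈D K → IsId x

IsIndependentSet : ∀ {n} → List (Sub n) → Set
IsIndependentSet L =
  All IsVertex L × AllPairs (λ H K → (H ≢ K) × TrivialMeet H K) L

IndependenceNumberIs : ℕ → ℕ → Set
IndependenceNumberIs n k =
  (∃ λ (L : List (Sub n)) → IsIndependentSet L × length L ≡ k) ×
  (∀ (L : List (Sub n)) → IsIndependentSet L → length L ≤ k)

-- Every proper non-trivial subgroup of D_{2p²} contains a reflection r^j s or a
-- non-trivial rotation; in the latter case it contains r^p, since the rotations
-- of a subgroup containing r^i contain r^gcd(i,p²) (Bézout) and gcd(i,p²) ∣ p.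
-- The p² + 1 elements r^p, r^j s are non-trivial, so subgroups of an independent
-- set contain pairwise different ones of them: at most p² + 1 subgroups. The
-- bound is attained by ⟨r^p⟩ together with the p² subgroups {1, r^j s}.
module Submission where

open import Defs
open import Data.Nat using (ℕ; zero; suc; _+_; _*_; _∸_; _≤_; _<_; _%_; s≤s; z≤n; _≤?_; >-nonZero; nonTrivial⇒n>1)
open import Data.Nat.Properties
open import Data.Nat.DivMod using (_mod_; m%n<n; m<n⇒m%n≡m; n%n≡0; %-distribˡ-+; m%n%n≡m%n; [m+kn]%n≡m%n; [m+n]%n≡m%n)
open import Data.Nat.Divisibility
open import Data.Nat.Primality using (Prime; prime⇒irreducible; prime⇒nonZero; prime⇒nonTrivial)
open import Data.Nat.Coprimality using (Coprime; coprime-divisor)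
open import Data.Nat.GCD using (gcd; gcd-GCD; gcd[m,n]∣m; gcd[m,n]∣n; module Bézout)
open import Data.Nat.Solver using (module +-*-Solver)
open import Data.Fin using (Fin; toℕ) renaming (zero to fzero; suc to fsuc; _<_ to _<ᶠ_)
open import Data.Fin.Properties using (toℕ-injective; toℕ-fromℕ<; toℕ<n; pigeonhole)
open import Data.Fin.Subset using (Subset; _∈_; ⁅_⁆; ⊥)
open import Data.Fin.Subset.Properties using (x∈⁅x⁆; x∈⁅y⁆⇒x≡y; ∉⊥)
open import Data.Vec using (tabulate)
open import Data.Vec.Properties using (lookup∘tabulate; lookup⇒[]=; []=⇒lookup)
open import Data.Bool using (Bool; true; false)
open import Data.Product using (_×_; _,_; ∃; proj₁; proj₂)
open import Data.Sum using (_⊎_; inj₁; inj₂)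
open import Data.Empty using (⊥-elim) renaming (⊥ to Empty)
open import Data.List using (List; _∷_; length; map; lookup; allFin)
open import Data.List.Properties using (length-map; length-tabulate)
open import Data.List.Relation.Unary.All as All using (All; _∷_)
open import Data.List.Relation.Unary.All.Properties using (map⁺)
open import Data.List.Relation.Unary.AllPairs as AllPairs using (AllPairs; _∷_)
import Data.List.Relation.Unary.AllPairs.Properties as AllPairsₚ
open import Data.List.Relation.Unary.Unique.Propositional.Properties using (allFin⁺)
open import Function using (_∘_)
open import Relation.Binary.PropositionalEquality
open import Relation.Nullary using (¬_; yes; no; contradiction; does)
open import Relation.Nullary.Decidable using (dec-true)

module _ {A : Set} where

  All-lookup : ∀ {P : A → Set} {xs} → All P xs → (i : Fin (length xs)) → P (lookup xs i)
  All-lookup (px ∷ _)   fzero    = px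
  All-lookup (_  ∷ pxs) (fsuc i) = All-lookup pxs i

  AllPairs-lookup : ∀ {R : A → A → Set} {xs} → AllPairs R xs →
                    ∀ {i j : Fin (length xs)} → i <ᶠ j → R (lookup xs i) (lookup xs j)
  AllPairs-lookup (Rx ∷ _)  {fzero}  {fsuc j} _         = All-lookup Rx j
  AllPairs-lookup (_  ∷ Rs) {fsuc i} {fsuc j} (s≤s i<j) = AllPairs-lookup Rs i<j

  length≤-of-separated : ∀ {k} (Has : A → Fin k → Set) {R : A → A → Set} →
                         (∀ {x y c} → R x y → Has x c → Has y c → Empty) →
                         ∀ {xs} → AllPairs R xs → All (λ x → ∃ (Has x)) xs → length xs ≤ k
  length≤-of-separated {k} Has separated {xs} related labelled with length xs ≤? k
  ... | yes ≤k = ≤k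
  ... | no  ≰k with pigeonhole (≰⇒> ≰k) (proj₁ ∘ All-lookup labelled)
  ... | i , j , i<j , same-label = ⊥-elim (
    separated (AllPairs-lookup related i<j)
              (proj₂ (All-lookup labelled i))
              (subst (Has (lookup xs j)) (sym same-label) (proj₂ (All-lookup labelled j))))

∣p*p⇒∣p⊎≡p*p : ∀ {p d} → Prime p → d ∣ p * p → d ∣ p ⊎ d ≡ p * p
∣p*p⇒∣p⊎≡p*p {p} {d} p-prime d∣pp with p ∣? d
... | no p∤d = inj₁ (coprime-divisor d⊥p d∣pp)
  where
  d⊥p : Coprime d p
  d⊥p {e} (e∣d , e∣p) with prime⇒irreducible p-prime e∣p
  ... | inj₁ e≡1 = e≡1
  ... | inj₂ refl = contradiction e∣d p∤d
... | yes (divides r refl) with prime⇒irreducible p-prime {r} (*-cancelʳ-∣ p {{prime⇒nonZero p-prime}} d∣pp)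
...   | inj₁ refl = inj₁ (subst (_∣ p) (sym (*-identityˡ p)) ∣-refl)
...   | inj₂ refl = inj₂ refl

module Dihedral (m : ℕ) where

  -- n ≥ 2, so that r ∉ {1, r^j s}
  n : ℕ
  n = 2 + m

  toℕ-mod : ∀ a → toℕ (a mod n) ≡ a % n
  toℕ-mod a = toℕ-fromℕ< (m%n<n a n)

  mod-cong : ∀ a b → a % n ≡ b % n → a mod n ≡ b mod n
  mod-cong a b eq = toℕ-injective (trans (toℕ-mod a) (trans eq (sym (toℕ-mod b))))

  mod-toℕ : (i : Fin n) → toℕ i mod n ≡ i
  mod-toℕ i = toℕ-injective (trans (toℕ-mod (toℕ i)) (m<n⇒m%n≡m (toℕ<n i)))

  %-absorbʳ-+ : ∀ a b → (a + b % n) % n ≡ (a + b) % n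
  %-absorbʳ-+ a b = begin
    (a + b % n) % n              ≡⟨ %-distribˡ-+ a (b % n) n ⟩
    (a % n + b % n % n) % n      ≡⟨ cong (λ z → (a % n + z) % n) (m%n%n≡m%n b n) ⟩
    (a % n + b % n) % n          ≡⟨ %-distribˡ-+ a b n ⟨
    (a + b) % n                  ∎
    where open ≡-Reasoning

  addF-mod : ∀ a b → addF (a mod n) (b mod n) ≡ (a + b) mod n
  addF-mod a b = mod-cong (toℕ (a mod n) + toℕ (b mod n)) (a + b) (begin
    (toℕ (a mod n) + toℕ (b mod n)) % n ≡⟨ cong₂ (λ x y → (x + y) % n) (toℕ-mod a) (toℕ-mod b) ⟩
    (a % n + b % n) % n                 ≡⟨ %-distribˡ-+ a b n ⟨
    (a + b) % n                         ∎)
    where open ≡-Reasoning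

  addF-negF : ∀ (i j : Fin n) → addF i (negF j) ≡ (toℕ i + (n ∸ toℕ j)) mod n
  addF-negF i j = mod-cong (toℕ i + toℕ (negF j)) (toℕ i + (n ∸ toℕ j))
    (trans (cong (λ z → (toℕ i + z) % n) (toℕ-mod (n ∸ toℕ j))) (%-absorbʳ-+ (toℕ i) (n ∸ toℕ j)))

  n-mod-n : n mod n ≡ fzero
  n-mod-n = toℕ-injective (trans (toℕ-mod n) (n%n≡0 n))

  addF-negF-zero : (i : Fin n) → addF i (negF fzero) ≡ i
  addF-negF-zero i = begin
    addF i (negF fzero)       ≡⟨ addF-negF i fzero ⟩
    (toℕ i + n) mod n         ≡⟨ mod-cong (toℕ i + n) (toℕ i) ([m+n]%n≡m%n (toℕ i) n) ⟩
    toℕ i mod n               ≡⟨ mod-toℕ i ⟩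
    i                         ∎
    where open ≡-Reasoning

  addF-inverseʳ : (i : Fin n) → addF i (negF i) ≡ fzero
  addF-inverseʳ i = begin
    addF i (negF i)           ≡⟨ addF-negF i i ⟩
    (toℕ i + (n ∸ toℕ i)) mod n ≡⟨ cong (_mod n) (m+[n∸m]≡n (<⇒≤ (toℕ<n i))) ⟩
    n mod n                   ≡⟨ n-mod-n ⟩
    fzero                     ∎
    where open ≡-Reasoning

  _rot∈_ : ℕ → Sub n → Set
  a rot∈ H = (a mod n , false) ∈D H

  bézout-mod : ∀ a → ∃ λ k → (k * a) % n ≡ gcd a n % n
  bézout-mod a with Bézout.identity (gcd-GCD a n)
  ... | Bézout.+- x y eq = x , trans (cong (_% n) (sym eq)) ([m+kn]%n≡m%n (gcd a n) y n)
  -- here x·a ≡ −d, so (n − 1)·x·a ≡ d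
  ... | Bézout.-+ x y eq = suc m * x , (begin
    (suc m * x * a) % n               ≡⟨ [m+kn]%n≡m%n (suc m * x * a) y n ⟨
    (suc m * x * a + y * n) % n       ≡⟨ cong (λ z → (suc m * x * a + z) % n) eq ⟨
    (suc m * x * a + (d + x * a)) % n ≡⟨ cong (_% n) ([n-1]xa+[d+xa]≡d+xa*n m x a d) ⟩
    (d + (x * a) * n) % n             ≡⟨ [m+kn]%n≡m%n d (x * a) n ⟩
    d % n                             ∎)
    where
    open ≡-Reasoning
    open +-*-Solver
    d = gcd a n
    [n-1]xa+[d+xa]≡d+xa*n : ∀ m x a d → suc m * x * a + (d + x * a) ≡ d + (x * a) * (2 + m)
    [n-1]xa+[d+xa]≡d+xa*n = solve 4 (λ m x a d → (con 1 :+ m) :* x :* a :+ (d :+ x :* a)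
                                          := d :+ (x :* a) :* (con 2 :+ m)) refl

  module SubgroupRotations {H : Sub n} (subgroup : IsSubgroup H) where

    private
      closed-· = proj₁ (proj₂ subgroup)

    ∈⇒rot∈ : ∀ {i} → (i , false) ∈D H → toℕ i rot∈ H
    ∈⇒rot∈ {i} i∈H = subst (λ j → (j , false) ∈D H) (sym (mod-toℕ i)) i∈H

    0-rot∈ : 0 rot∈ H
    0-rot∈ = proj₁ subgroup (0 mod n , false) (refl , refl)

    +-rot∈ : ∀ {a b} → a rot∈ H → b rot∈ H → (a + b) rot∈ H
    +-rot∈ {a} {b} a∈H b∈H =
      subst (λ i → (i , false) ∈D H) (addF-mod a b) (closed-· (a mod n , false) (b mod n , false) a∈H b∈H)

    *-rot∈ : ∀ {a} → a rot∈ H → ∀ k → (k * a) rot∈ H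
    *-rot∈ a∈H zero    = 0-rot∈
    *-rot∈ {a} a∈H (suc k) = +-rot∈ {a} {k * a} a∈H (*-rot∈ a∈H k)

    %-rot∈ : ∀ {a b} → a % n ≡ b % n → a rot∈ H → b rot∈ H
    %-rot∈ {a} {b} eq = subst (λ i → (i , false) ∈D H) (mod-cong a b eq)

    gcd-rot∈ : ∀ {a} → a rot∈ H → gcd a n rot∈ H
    gcd-rot∈ {a} a∈H with k , eq ← bézout-mod a = %-rot∈ {k * a} {gcd a n} eq (*-rot∈ a∈H k)

  reflectionSubgroup : Fin n → Sub n
  reflectionSubgroup j = ⁅ fzero ⁆ , ⁅ j ⁆

  reflectionSubgroup-isSubgroup : ∀ j → IsSubgroup (reflectionSubgroup j)
  reflectionSubgroup-isSubgroup j = contains-identity , closed-· , closed-inv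
    where
    H = reflectionSubgroup j

    contains-identity : ∀ x → IsId x → x ∈D H
    contains-identity (i , false) (i≡0 , _) = subst (_∈ ⁅ fzero ⁆) (sym (toℕ-injective i≡0)) (x∈⁅x⁆ fzero)

    closed-· : ∀ x y → x ∈D H → y ∈D H → (x · y) ∈D H
    closed-· (i , false) (k , false) i∈ k∈
      with refl ← x∈⁅y⁆⇒x≡y fzero i∈ | refl ← x∈⁅y⁆⇒x≡y fzero k∈ = x∈⁅x⁆ fzero
    closed-· (i , false) (k , true) i∈ k∈
      with refl ← x∈⁅y⁆⇒x≡y fzero i∈ | refl ← x∈⁅y⁆⇒x≡y j k∈ =
      subst (_∈ ⁅ j ⁆) (sym (mod-toℕ j)) (x∈⁅x⁆ j)
    closed-· (i , true) (k , false) i∈ k∈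
      with refl ← x∈⁅y⁆⇒x≡y j i∈ | refl ← x∈⁅y⁆⇒x≡y fzero k∈ =
      subst (_∈ ⁅ j ⁆) (sym (addF-negF-zero j)) (x∈⁅x⁆ j)
    closed-· (i , true) (k , true) i∈ k∈
      with refl ← x∈⁅y⁆⇒x≡y j i∈ | refl ← x∈⁅y⁆⇒x≡y j k∈ =
      subst (_∈ ⁅ fzero ⁆) (sym (addF-inverseʳ j)) (x∈⁅x⁆ fzero)

    closed-inv : ∀ x → x ∈D H → inv x ∈D H
    closed-inv (i , false) i∈ with refl ← x∈⁅y⁆⇒x≡y fzero i∈ = subst (_∈ ⁅ fzero ⁆) (sym n-mod-n) (x∈⁅x⁆ fzero)
    closed-inv (i , true)  i∈ = i∈

  reflectionSubgroup-isVertex : ∀ j → IsVertex (reflectionSubgroup j)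
  reflectionSubgroup-isVertex j =
    reflectionSubgroup-isSubgroup j ,
    ((j , true) , x∈⁅x⁆ j , λ ()) ,
    ((fsuc fzero , false) , λ r∈ → contradiction (x∈⁅y⁆⇒x≡y fzero r∈) λ ())

  divisibleBy : ℕ → Fin n → Bool
  divisibleBy d i = does (d ∣? toℕ i)

  multiplesOf : ℕ → Subset n
  multiplesOf d = tabulate (divisibleBy d)

  ∈-multiplesOf : ∀ {d i} → d ∣ toℕ i → i ∈ multiplesOf d
  ∈-multiplesOf {d} {i} d∣i =
    lookup⇒[]= i (multiplesOf d) (trans (lookup∘tabulate (divisibleBy d) i) (dec-true (d ∣? toℕ i) d∣i))

  ∈-multiplesOf⁻ : ∀ {d i} → i ∈ multiplesOf d → d ∣ toℕ i
  ∈-multiplesOf⁻ {d} {i} i∈ with d ∣? toℕ i | trans (sym (lookup∘tabulate (divisibleBy d) i)) ([]=⇒lookup i∈)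
  ... | yes d∣i | _  = d∣i
  ... | no  _   | ()

  rotationSubgroup : ℕ → Sub n
  rotationSubgroup d = multiplesOf d , ⊥

  rotationSubgroup-isSubgroup : ∀ {d} → d ∣ n → IsSubgroup (rotationSubgroup d)
  rotationSubgroup-isSubgroup {d} d∣n = contains-identity , closed-· , closed-inv
    where
    H = rotationSubgroup d

    ∈-H : ∀ a → d ∣ a → (a mod n , false) ∈D H
    ∈-H a d∣a = ∈-multiplesOf (subst (d ∣_) (sym (toℕ-mod a)) (%-presˡ-∣ d∣a d∣n))

    contains-identity : ∀ x → IsId x → x ∈D H
    contains-identity (i , false) (i≡0 , _) = ∈-multiplesOf (subst (d ∣_) (sym i≡0) (d ∣0))

    closed-· : ∀ x y → x ∈D H → y ∈D H → (x · y) ∈D H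
    closed-· (i , false) (k , false) i∈ k∈ =
      ∈-H (toℕ i + toℕ k) (∣m∣n⇒∣m+n (∈-multiplesOf⁻ i∈) (∈-multiplesOf⁻ k∈))
    closed-· (i , false) (k , true) _  k∈ = ⊥-elim (∉⊥ k∈)
    closed-· (i , true)  _          i∈ _  = ⊥-elim (∉⊥ i∈)

    closed-inv : ∀ x → x ∈D H → inv x ∈D H
    closed-inv (i , false) i∈ = ∈-H (n ∸ toℕ i) (∣m+n∣m⇒∣n d∣i+[n∸i] (∈-multiplesOf⁻ i∈))
      where
      d∣i+[n∸i] : d ∣ toℕ i + (n ∸ toℕ i)
      d∣i+[n∸i] = subst (d ∣_) (sym (m+[n∸m]≡n (<⇒≤ (toℕ<n i)))) d∣n
    closed-inv (i , true)  i∈ = ⊥-elim (∉⊥ i∈)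

  rotationSubgroup-isVertex : ∀ {d} → 0 < d → d < n → d ∣ n → IsVertex (rotationSubgroup d)
  rotationSubgroup-isVertex {d} 0<d d<n d∣n =
    rotationSubgroup-isSubgroup d∣n ,
    ((d mod n , false) , ∈-multiplesOf (subst (d ∣_) (sym toℕ[d]≡d) ∣-refl) ,
                         λ (d≡0 , _) → <⇒≢ 0<d (sym (trans (sym toℕ[d]≡d) d≡0))) ,
    ((fzero , true) , ∉⊥)
    where
    toℕ[d]≡d : toℕ (d mod n) ≡ d
    toℕ[d]≡d = trans (toℕ-mod d) (m<n⇒m%n≡m d<n)

  reflectionSubgroups-separated : ∀ {j k} → j ≢ k →
    (reflectionSubgroup j ≢ reflectionSubgroup k) × TrivialMeet (reflectionSubgroup j) (reflectionSubgroup k)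
  reflectionSubgroups-separated {j} {k} j≢k = distinct , trivial-meet
    where
    distinct : reflectionSubgroup j ≢ reflectionSubgroup k
    distinct eq = j≢k (x∈⁅y⁆⇒x≡y k (subst (λ H → j ∈ proj₂ H) eq (x∈⁅x⁆ j)))

    trivial-meet : TrivialMeet (reflectionSubgroup j) (reflectionSubgroup k)
    trivial-meet (i , false) i∈ _ = cong toℕ (x∈⁅y⁆⇒x≡y fzero i∈) , refl
    trivial-meet (i , true)  i∈j i∈k = ⊥-elim (j≢k (trans (sym (x∈⁅y⁆⇒x≡y j i∈j)) (x∈⁅y⁆⇒x≡y k i∈k)))

  rotation-reflection-separated : ∀ d j →
    (rotationSubgroup d ≢ reflectionSubgroup j) × TrivialMeet (rotationSubgroup d) (reflectionSubgroup j)
  rotation-reflection-separated d j = distinct , trivial-meet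
    where
    distinct : rotationSubgroup d ≢ reflectionSubgroup j
    distinct eq = ∉⊥ (subst (λ H → j ∈ proj₂ H) (sym eq) (x∈⁅x⁆ j))

    trivial-meet : TrivialMeet (rotationSubgroup d) (reflectionSubgroup j)
    trivial-meet (i , false) _  i∈ = cong toℕ (x∈⁅y⁆⇒x≡y fzero i∈) , refl
    trivial-meet (i , true)  i∈ _  = ⊥-elim (∉⊥ i∈)

  independentSet-rotation∷reflections : ∀ {d} → 0 < d → d < n → d ∣ n →
    ∃ λ (L : List (Sub n)) → IsIndependentSet L × length L ≡ n + 1
  independentSet-rotation∷reflections {d} 0<d d<n d∣n =
    rotationSubgroup d ∷ reflections ,
    (rotationSubgroup-isVertex 0<d d<n d∣n ∷ map⁺ (All.universal reflectionSubgroup-isVertex (allFin n)) ,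
     map⁺ (All.universal (rotation-reflection-separated d) (allFin n)) ∷
       AllPairsₚ.map⁺ (AllPairs.map reflectionSubgroups-separated (allFin⁺ n))) ,
    (begin
      suc (length reflections) ≡⟨ cong suc (length-map reflectionSubgroup (allFin n)) ⟩
      suc (length (allFin n))  ≡⟨ cong suc (length-tabulate {n = n} (λ i → i)) ⟩
      suc n                    ≡⟨ +-comm 1 n ⟩
      n + 1                    ∎)
    where
    open ≡-Reasoning
    reflections = map reflectionSubgroup (allFin n)

module SquareOfPrime (q : ℕ) (p-prime : Prime (2 + q)) where

  p : ℕ
  p = 2 + q

  -- n reduces to p * p
  open Dihedral (p * p ∸ 2)

  p<n : p < n
  p<n = m<m*n p p (s≤s (s≤s z≤n))

  gcd∣p : ∀ {a} → 0 < a → a < n → gcd a n ∣ p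
  gcd∣p {a} 0<a a<n with ∣p*p⇒∣p⊎≡p*p p-prime (gcd[m,n]∣n a n)
  ... | inj₁ gcd∣p = gcd∣p
  ... | inj₂ gcd≡n = contradiction (∣⇒≤ {{>-nonZero 0<a}} (gcd[m,n]∣m a n))
                                   (<⇒≱ (subst (a <_) (sym gcd≡n) a<n))

  rotation∈⇒r^p∈ : ∀ {H i} → IsSubgroup H → (i , false) ∈D H → toℕ i ≢ 0 → p rot∈ H
  rotation∈⇒r^p∈ {H} {i} subgroup i∈H i≢0
    with divides c p≡c*gcd ← gcd∣p (n≢0⇒n>0 i≢0) (toℕ<n i) =
    subst (_rot∈ H) (sym p≡c*gcd) (*-rot∈ {gcd (toℕ i) n} (gcd-rot∈ {toℕ i} (∈⇒rot∈ i∈H)) c)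
    where open SubgroupRotations subgroup

  witness : Fin (suc n) → D n
  witness fzero    = p mod n , false
  witness (fsuc j) = j , true

  witness-nonIdentity : ∀ c → ¬ IsId (witness c)
  witness-nonIdentity fzero (p≡0 , _) with () ← trans (sym (trans (toℕ-mod p) (m<n⇒m%n≡m p<n))) p≡0
  witness-nonIdentity (fsuc j) (_ , ())

  vertex∋witness : ∀ {H} → IsVertex H → ∃ λ c → witness c ∈D H
  vertex∋witness (_ , ((i , true) , i∈H , _) , _) = fsuc i , i∈H
  vertex∋witness (subgroup , ((i , false) , i∈H , nonId) , _) =
    fzero , rotation∈⇒r^p∈ subgroup i∈H (λ i≡0 → nonId (i≡0 , refl))

  independentSet-length≤ : ∀ L → IsIndependentSet L → length L ≤ n + 1
  independentSet-length≤ L (vertices , separated) =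
    subst (length L ≤_) (+-comm 1 n)
      (length≤-of-separated (λ H c → witness c ∈D H)
        (λ {_} {_} {c} (_ , trivial-meet) c∈H c∈K → witness-nonIdentity c (trivial-meet (witness c) c∈H c∈K))
        separated (All.map vertex∋witness vertices))

  independenceNumber : IndependenceNumberIs n (n + 1)
  independenceNumber = independentSet-rotation∷reflections (s≤s z≤n) p<n (n∣m*n p) , independentSet-length≤

corollary2p7 : (p : ℕ) → Prime p → IndependenceNumberIs (p * p) (p * p + 1)
corollary2p7 p p-prime with nonTrivial⇒n>1 p {{prime⇒nonTrivial p-prime}}
... | s≤s (s≤s _) = SquareOfPrime.independenceNumber _ p-prime
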